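{- Let $M=(E,\mathcal{I})$ be a matroid with rank function $r$, let $A$ be a base, $A_1\subseteq A$, and $B_1$ an independent set with $A\cap B_1=\emptyset$. Let $t\ge 0$ be an integer. If $|A_1|+|B_1|-r(A_1\cup B_1)\ge t$, then there exist $A_2\subseteq A_1$ and $B_2\subseteq B_1$ with $|A_2|=|B_2|=t$ such that $(A\setminus A_2)\cup B_2$ is a base of $M$.
   Context: Matroids are finite and loopless. -}

module Defs where

open import Data.Bool using (Bool; true; false)
open import Data.Nat using (ℕ; zero; suc; _<_; _≤_; _+_; _⊔_)
open import Data.Fin using (Fin)
open import Data.Fin.Subset using (Subset; _⊆_; _∈_; _∉_; ∣_∣; ⊥; ⁅_⁆; _∪_; _∩_; _─_)
open import Data.Fin.Subset.Properties using (_⊆?_)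
open import Data.List using (List; []; _∷_; map; _++_; foldr)
open import Data.Vec using (_∷_; [])
open import Data.Product using (Σ; _×_; _,_)
open import Relation.Nullary using (¬_; Dec; yes; no)
open import Relation.Unary using (Decidable)

-- Independence is assumed decidable (harmless for a finite set system;
-- needed to define the rank function constructively).
record Matroid (n : ℕ) : Set₁ where
  field
    Indep         : Subset n → Set
    indep?        : Decidable Indep
    indep-empty   : Indep ⊥
    indep-subset  : ∀ {X Y} → Y ⊆ X → Indep X → Indep Y
    indep-augment : ∀ {X Y} → Indep X → Indep Y → ∣ X ∣ < ∣ Y ∣ →
                    Σ (Fin n) λ e → e ∈ Y × e ∉ X × Indep (X ∪ ⁅ e ⁆)
    loopless      : ∀ (e : Fin n) → Indep ⁅ e ⁆

allSubsets : (n : ℕ) → List (Subset n)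
allSubsets zero    = [] ∷ []
allSubsets (suc n) = map (true ∷_) (allSubsets n) ++ map (false ∷_) (allSubsets n)

module _ {n : ℕ} (M : Matroid n) where
  open Matroid M

  IsBase : Subset n → Set
  IsBase X = Indep X × (∀ Y → Indep Y → X ⊆ Y → Y ⊆ X)

  rank : Subset n → ℕ
  rank X = foldr (λ Y acc → val Y ⊔ acc) 0 (allSubsets n)
    where
    val : Subset n → ℕ
    val Y with Y ⊆? X | indep? Y
    ... | yes _ | yes _ = ∣ Y ∣
    ... | _     | _     = 0

-- Extend the independent set A ─ A₁ greedily by elements of B₁ to a maximal
-- independent J ⊆ (A ─ A₁) ∪ B₁. An instance of submodularity,
-- r(A ∪ B₁) + r(B₁) ≤ r((A ─ A₁) ∪ B₁) + r(A₁ ∪ B₁), shows that J uses at least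
-- t elements of B₁; let B₂ be t of them. Extending the independent set
-- (A ─ A₁) ∪ B₂ by elements of A to a base, the base must be (A ─ A₂) ∪ B₂ for
-- the set A₂ ⊆ A₁ of elements left out, and comparing sizes with A gives |A₂| = t.
module Submission where

open import Defs
open import Data.Nat using (ℕ; zero; suc; _≤_; _+_; _⊔_; s≤s)
open import Data.Nat.Properties
open import Data.Fin using (Fin)
open import Data.Fin.Subset using (Subset; _⊆_; _∈_; _∉_; ∣_∣; ⊥; ⁅_⁆; _∪_; _∩_; _─_; inside; outside; Empty)
open import Data.Fin.Subset.Properties
open import Data.Vec using (_∷_; []; here; there)
open import Data.List using (List; _∷_; map; foldr)
open import Data.List.Membership.Propositional using () renaming (_∈_ to _∈ˡ_)
open import Data.List.Membership.Propositional.Properties using (∈-map⁺; ∈-++⁺ˡ; ∈-++⁺ʳ)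
open import Data.List.Relation.Unary.Any using (here; there)
open import Data.Product using (Σ; _×_; _,_; proj₁)
open import Data.Sum using (inj₁; inj₂)
open import Data.Empty using (⊥-elim)
open import Function using (id; _∘_)
open import Relation.Nullary using (¬_; yes; no)
open import Relation.Nullary.Decidable using (_×-dec_; ¬?)
open import Relation.Binary.PropositionalEquality using (_≡_; refl; sym; trans; cong; subst)
open import Data.Fin.Properties using (any?)

private
  variable
    n : ℕ

∣p∪q∣+∣p∩q∣≡∣p∣+∣q∣ : (p q : Subset n) → ∣ p ∪ q ∣ + ∣ p ∩ q ∣ ≡ ∣ p ∣ + ∣ q ∣
∣p∪q∣+∣p∩q∣≡∣p∣+∣q∣ []            []            = refl
∣p∪q∣+∣p∩q∣≡∣p∣+∣q∣ (inside  ∷ p) (inside  ∷ q) =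
  cong suc (trans (+-suc _ _) (trans (cong suc (∣p∪q∣+∣p∩q∣≡∣p∣+∣q∣ p q)) (sym (+-suc _ _))))
∣p∪q∣+∣p∩q∣≡∣p∣+∣q∣ (inside  ∷ p) (outside ∷ q) = cong suc (∣p∪q∣+∣p∩q∣≡∣p∣+∣q∣ p q)
∣p∪q∣+∣p∩q∣≡∣p∣+∣q∣ (outside ∷ p) (inside  ∷ q) =
  trans (cong suc (∣p∪q∣+∣p∩q∣≡∣p∣+∣q∣ p q)) (sym (+-suc _ _))
∣p∪q∣+∣p∩q∣≡∣p∣+∣q∣ (outside ∷ p) (outside ∷ q) = ∣p∪q∣+∣p∩q∣≡∣p∣+∣q∣ p q

∣p∪q∣≤∣p∣+∣q∣ : (p q : Subset n) → ∣ p ∪ q ∣ ≤ ∣ p ∣ + ∣ q ∣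
∣p∪q∣≤∣p∣+∣q∣ p q = subst (∣ p ∪ q ∣ ≤_) (∣p∪q∣+∣p∩q∣≡∣p∣+∣q∣ p q) (m≤m+n _ _)

Empty-∩⇒∣p∪q∣≡∣p∣+∣q∣ : (p q : Subset n) → Empty (p ∩ q) → ∣ p ∪ q ∣ ≡ ∣ p ∣ + ∣ q ∣
Empty-∩⇒∣p∪q∣≡∣p∣+∣q∣ {n} p q empty = begin
  ∣ p ∪ q ∣                 ≡⟨ sym (+-identityʳ _) ⟩
  ∣ p ∪ q ∣ + 0             ≡⟨ cong (∣ p ∪ q ∣ +_) (sym (∣⊥∣≡0 n)) ⟩
  ∣ p ∪ q ∣ + ∣ ⊥ {n} ∣      ≡⟨ cong (λ r → ∣ p ∪ q ∣ + ∣ r ∣) (sym (Empty-unique empty)) ⟩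
  ∣ p ∪ q ∣ + ∣ p ∩ q ∣     ≡⟨ ∣p∪q∣+∣p∩q∣≡∣p∣+∣q∣ p q ⟩
  ∣ p ∣ + ∣ q ∣             ∎
  where open Relation.Binary.PropositionalEquality.≡-Reasoning

∣p─q∣+∣q∣≡∣p∣ : (p q : Subset n) → q ⊆ p → ∣ p ─ q ∣ + ∣ q ∣ ≡ ∣ p ∣
∣p─q∣+∣q∣≡∣p∣ []            []            q⊆p = refl
∣p─q∣+∣q∣≡∣p∣ (inside  ∷ p) (inside  ∷ q) q⊆p = trans (+-suc _ _) (cong suc (∣p─q∣+∣q∣≡∣p∣ p q (drop-∷-⊆ q⊆p)))
∣p─q∣+∣q∣≡∣p∣ (inside  ∷ p) (outside ∷ q) q⊆p = cong suc (∣p─q∣+∣q∣≡∣p∣ p q (drop-∷-⊆ q⊆p))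
∣p─q∣+∣q∣≡∣p∣ (outside ∷ p) (inside  ∷ q) q⊆p with () ← q⊆p here
∣p─q∣+∣q∣≡∣p∣ (outside ∷ p) (outside ∷ q) q⊆p = ∣p─q∣+∣q∣≡∣p∣ p q (drop-∷-⊆ q⊆p)

x∈p─q⇒x∉q : ∀ {x : Fin n} (p q : Subset n) → x ∈ p ─ q → x ∉ q
x∈p─q⇒x∉q (inside ∷ p) (outside ∷ q) here       ()
x∈p─q⇒x∉q (_      ∷ p) (_       ∷ q) (there x∈) (there x∈q) = x∈p─q⇒x∉q p q x∈ x∈q

∣p∪⁅x⁆∣≡1+∣p∣ : ∀ (p : Subset n) {x} → x ∉ p → ∣ p ∪ ⁅ x ⁆ ∣ ≡ suc ∣ p ∣
∣p∪⁅x⁆∣≡1+∣p∣ p {x} x∉p = begin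
  ∣ p ∪ ⁅ x ⁆ ∣       ≡⟨ Empty-∩⇒∣p∪q∣≡∣p∣+∣q∣ p ⁅ x ⁆ x∉p∩⁅x⁆ ⟩
  ∣ p ∣ + ∣ ⁅ x ⁆ ∣   ≡⟨ cong (∣ p ∣ +_) (∣⁅x⁆∣≡1 x) ⟩
  ∣ p ∣ + 1           ≡⟨ +-comm _ 1 ⟩
  suc ∣ p ∣           ∎
  where
  open Relation.Binary.PropositionalEquality.≡-Reasoning
  x∉p∩⁅x⁆ : Empty (p ∩ ⁅ x ⁆)
  x∉p∩⁅x⁆ (y , y∈) with y∈p , y∈⁅x⁆ ← x∈p∩q⁻ p ⁅ x ⁆ y∈ = x∉p (subst (_∈ p) (x∈⁅y⁆⇒x≡y x y∈⁅x⁆) y∈p)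

⊆-of-size : ∀ (p : Subset n) t → t ≤ ∣ p ∣ → Σ (Subset n) λ q → q ⊆ p × ∣ q ∣ ≡ t
⊆-of-size {n}     p             zero    _         = ⊥ , ⊥⊆ , ∣⊥∣≡0 n
⊆-of-size         (inside  ∷ p) (suc t) (s≤s t≤p) with q , q⊆p , ∣q∣≡t ← ⊆-of-size p t t≤p =
  inside ∷ q , (λ { here → here ; (there x∈q) → there (q⊆p x∈q) }) , cong suc ∣q∣≡t
⊆-of-size         (outside ∷ p) (suc t) t≤p       with q , q⊆p , ∣q∣≡t ← ⊆-of-size p (suc t) t≤p =
  outside ∷ q , (λ { (there x∈q) → there (q⊆p x∈q) }) , ∣q∣≡t

p⊆q∧∣q∣≤∣p∣⇒q⊆p : ∀ {p q : Subset n} → p ⊆ q → ∣ q ∣ ≤ ∣ p ∣ → q ⊆ p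
p⊆q∧∣q∣≤∣p∣⇒q⊆p {p = p} p⊆q ∣q∣≤∣p∣ {x} x∈q with x ∈? p
... | yes x∈p = x∈p
... | no  x∉p = ⊥-elim (<⇒≱ (p⊂q⇒∣p∣<∣q∣ (p⊆q , x , x∈q , x∉p)) ∣q∣≤∣p∣)

p─[q─r]∪s≡r : ∀ (p q s r : Subset n) → (p ─ q) ∪ s ⊆ r → r ⊆ p ∪ s → (p ─ (q ─ r)) ∪ s ≡ r
p─[q─r]∪s≡r p q s r p─q∪s⊆r r⊆p∪s = ⊆-antisym ⊆r r⊆
  where
  ⊆r : (p ─ (q ─ r)) ∪ s ⊆ r
  ⊆r {x} x∈ with x∈p∪q⁻ (p ─ (q ─ r)) s x∈ | x ∈? r
  ... | _        | yes x∈r = x∈r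
  ... | inj₂ x∈s | no _    = p─q∪s⊆r (q⊆p∪q (p ─ q) s x∈s)
  ... | inj₁ x∈  | no x∉r  = p─q∪s⊆r (p⊆p∪q s (x∈p∧x∉q⇒x∈p─q (p─q⊆p p (q ─ r) x∈) x∉q))
    where
    x∉q : x ∉ q
    x∉q x∈q = x∈p─q⇒x∉q p (q ─ r) x∈ (x∈p∧x∉q⇒x∈p─q x∈q x∉r)
  r⊆ : r ⊆ (p ─ (q ─ r)) ∪ s
  r⊆ {x} x∈r with x∈p∪q⁻ p s (r⊆p∪s x∈r)
  ... | inj₁ x∈p = p⊆p∪q s (x∈p∧x∉q⇒x∈p─q x∈p (λ x∈q─r → x∈p─q⇒x∉q q r x∈q─r x∈r))
  ... | inj₂ x∈s = q⊆p∪q _ s x∈s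

∈-allSubsets : (p : Subset n) → p ∈ˡ allSubsets n
∈-allSubsets []                = here refl
∈-allSubsets {suc n} (inside  ∷ p) = ∈-++⁺ˡ (∈-map⁺ (inside ∷_) (∈-allSubsets p))
∈-allSubsets {suc n} (outside ∷ p) = ∈-++⁺ʳ (map (inside ∷_) (allSubsets n)) (∈-map⁺ (outside ∷_) (∈-allSubsets p))

-- The summand in the definition of rank is local to Defs and cannot be named;
-- stating the bound against an equation lets it be inferred by unification.
f≤foldr-⊔ : ∀ {A : Set} (f : A → ℕ) {y m} (xs : List A) → y ∈ˡ xs →
            foldr (λ z acc → f z ⊔ acc) 0 xs ≡ m → f y ≤ m
f≤foldr-⊔ f (x ∷ xs) (here refl) refl = m≤m⊔n _ _
f≤foldr-⊔ f (x ∷ xs) (there y∈)  refl = ≤-trans (f≤foldr-⊔ f xs y∈ refl) (m≤n⊔m _ _)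

module _ (M : Matroid n) where
  open Matroid M

  ∣indep∣≤rank : ∀ {X Y} → Y ⊆ X → Indep Y → ∣ Y ∣ ≤ rank M X
  ∣indep∣≤rank {X} {Y} Y⊆X indY
    with Y ⊆? X | indep? Y | f≤foldr-⊔ _ {m = rank M X} (allSubsets n) (∈-allSubsets Y) refl
  ... | yes _   | yes _    | ∣Y∣≤r = ∣Y∣≤r
  ... | no Y⊈X  | _        | _     = ⊥-elim (Y⊈X Y⊆X)
  ... | yes _   | no ¬indY | _     = ⊥-elim (¬indY indY)

  MaximalIn : Subset n → Subset n → Set
  MaximalIn S J = ∀ {e} → e ∈ S → e ∉ J → ¬ Indep (J ∪ ⁅ e ⁆)

  record MaximalExtension (I S : Subset n) : Set where
    field
      J       : Subset n
      indep   : Indep J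
      I⊆J     : I ⊆ J
      J⊆I∪S   : J ⊆ I ∪ S
      maximal : MaximalIn S J

  extend : ∀ {I} S → Indep I → MaximalExtension I S
  extend {I} S indI = go n I indI id (p⊆p∪q S) (m≤m+n n ∣ I ∣)
    where
    go : ∀ k J → Indep J → I ⊆ J → J ⊆ I ∪ S → n ≤ k + ∣ J ∣ → MaximalExtension I S
    go k J indJ I⊆J J⊆I∪S n≤k+∣J∣
      with any? (λ e → (e ∈? S) ×-dec ¬? (e ∈? J) ×-dec indep? (J ∪ ⁅ e ⁆))
    ... | no ¬addable = record
      { J = J ; indep = indJ ; I⊆J = I⊆J ; J⊆I∪S = J⊆I∪S
      ; maximal = λ e∈S e∉J ind → ¬addable (_ , e∈S , e∉J , ind) }
    go zero J _ _ _ n≤∣J∣ | yes (e , _ , e∉J , _) =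
      ⊥-elim (<⇒≱ (subst (_≤ n) (∣p∪⁅x⁆∣≡1+∣p∣ J e∉J) (∣p∣≤n (J ∪ ⁅ e ⁆))) n≤∣J∣)
    go (suc k) J _ I⊆J J⊆I∪S n≤k+∣J∣ | yes (e , e∈S , e∉J , indJe) =
      go k (J ∪ ⁅ e ⁆) indJe (p⊆p∪q ⁅ e ⁆ ∘ I⊆J) Je⊆I∪S
        (subst (n ≤_) (trans (sym (+-suc k ∣ J ∣)) (cong (k +_) (sym (∣p∪⁅x⁆∣≡1+∣p∣ J e∉J)))) n≤k+∣J∣)
      where
      Je⊆I∪S : J ∪ ⁅ e ⁆ ⊆ I ∪ S
      Je⊆I∪S {x} x∈ with x∈p∪q⁻ J ⁅ e ⁆ x∈
      ... | inj₁ x∈J = J⊆I∪S x∈J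
      ... | inj₂ x∈e = q⊆p∪q I S (subst (_∈ S) (sym (x∈⁅y⁆⇒x≡y e x∈e)) e∈S)

  ∣indep∣≤∣maximal∣ : ∀ {J S Y} → Indep J → MaximalIn S J → Indep Y → Y ⊆ J ∪ S → ∣ Y ∣ ≤ ∣ J ∣
  ∣indep∣≤∣maximal∣ {J} {S} {Y} indJ maxJ indY Y⊆J∪S with ∣ Y ∣ ≤? ∣ J ∣
  ... | yes ∣Y∣≤∣J∣ = ∣Y∣≤∣J∣
  ... | no  ∣Y∣≰∣J∣ with e , e∈Y , e∉J , indJe ← indep-augment indJ indY (≰⇒> ∣Y∣≰∣J∣)
                    with x∈p∪q⁻ J S (Y⊆J∪S e∈Y)
  ... | inj₁ e∈J = ⊥-elim (e∉J e∈J)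
  ... | inj₂ e∈S = ⊥-elim (maxJ e∈S e∉J indJe)

  base⇒maximalIn : ∀ {A} S → IsBase M A → MaximalIn S A
  base⇒maximalIn {A} _ (_ , maxA) {e} _ e∉A indAe = e∉A (maxA _ indAe (p⊆p∪q ⁅ e ⁆) (q⊆p∪q A ⁅ e ⁆ (x∈⁅x⁆ e)))

  ∣indep∣≤∣base∣ : ∀ {A Y} → IsBase M A → Indep Y → ∣ Y ∣ ≤ ∣ A ∣
  ∣indep∣≤∣base∣ {A} {Y} baseA indY =
    ∣indep∣≤∣maximal∣ (proj₁ baseA) (base⇒maximalIn Y baseA) indY (q⊆p∪q A Y)

  ∣base∣≤∣indep∣⇒base : ∀ {A Z} → IsBase M A → Indep Z → ∣ A ∣ ≤ ∣ Z ∣ → IsBase M Z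
  ∣base∣≤∣indep∣⇒base baseA indZ ∣A∣≤∣Z∣ =
    indZ , λ W indW Z⊆W → p⊆q∧∣q∣≤∣p∣⇒q⊆p Z⊆W (≤-trans (∣indep∣≤∣base∣ baseA indW) ∣A∣≤∣Z∣)

  -- r(C ∪ D ∪ B) + r(B) ≤ r(C ∪ B) + r(D ∪ B), with r(C ∪ D ∪ B) witnessed by X
  -- and r(C ∪ B) by the extension J of C.
  submodular-bound : ∀ {X B} C D → Indep X → X ⊆ C ∪ D → Indep B → (E : MaximalExtension C B) →
                     ∣ X ∣ + ∣ B ∣ ≤ ∣ MaximalExtension.J E ∣ + rank M (D ∪ B)
  submodular-bound {X} {B} C D indX X⊆C∪D indB E = begin
    ∣ X ∣ + ∣ B ∣               ≤⟨ +-mono-≤ ∣X∣≤∣Y₁∪Y₂∣ (p⊆q⇒∣p∣≤∣q∣ B⊆Y₁∩Y₂) ⟩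
    ∣ Y₁ ∪ Y₂ ∣ + ∣ Y₁ ∩ Y₂ ∣   ≡⟨ ∣p∪q∣+∣p∩q∣≡∣p∣+∣q∣ Y₁ Y₂ ⟩
    ∣ Y₁ ∣ + ∣ Y₂ ∣             ≤⟨ +-mono-≤ ∣Y₁∣≤∣J∣ ∣Y₂∣≤r ⟩
    ∣ J ∣ + rank M (D ∪ B)      ∎
    where
    open ≤-Reasoning
    open MaximalExtension E
    module K = MaximalExtension (extend {B} X indB)
    Y₁ Y₂ : Subset n
    Y₁ = K.J ∩ (C ∪ B)
    Y₂ = K.J ∩ (D ∪ B)

    ∣X∣≤∣Y₁∪Y₂∣ : ∣ X ∣ ≤ ∣ Y₁ ∪ Y₂ ∣
    ∣X∣≤∣Y₁∪Y₂∣ = ≤-trans (∣indep∣≤∣maximal∣ K.indep K.maximal indX (q⊆p∪q K.J X))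
                          (p⊆q⇒∣p∣≤∣q∣ K⊆Y₁∪Y₂)
      where
      K⊆Y₁∪Y₂ : K.J ⊆ Y₁ ∪ Y₂
      K⊆Y₁∪Y₂ {x} x∈K with x∈p∪q⁻ B X (K.J⊆I∪S x∈K)
      ... | inj₁ x∈B = p⊆p∪q Y₂ (x∈p∩q⁺ (x∈K , q⊆p∪q C B x∈B))
      ... | inj₂ x∈X with x∈p∪q⁻ C D (X⊆C∪D x∈X)
      ... | inj₁ x∈C = p⊆p∪q Y₂ (x∈p∩q⁺ (x∈K , p⊆p∪q B x∈C))
      ... | inj₂ x∈D = q⊆p∪q Y₁ Y₂ (x∈p∩q⁺ (x∈K , p⊆p∪q B x∈D))

    B⊆Y₁∩Y₂ : B ⊆ Y₁ ∩ Y₂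
    B⊆Y₁∩Y₂ x∈B = x∈p∩q⁺ (x∈p∩q⁺ (K.I⊆J x∈B , q⊆p∪q C B x∈B) , x∈p∩q⁺ (K.I⊆J x∈B , q⊆p∪q D B x∈B))

    ∣Y₁∣≤∣J∣ : ∣ Y₁ ∣ ≤ ∣ J ∣
    ∣Y₁∣≤∣J∣ = ∣indep∣≤∣maximal∣ indep maximal (indep-subset (p∩q⊆p K.J _) K.indep) Y₁⊆J∪B
      where
      Y₁⊆J∪B : Y₁ ⊆ J ∪ B
      Y₁⊆J∪B {x} x∈Y₁ with x∈p∪q⁻ C B (p∩q⊆q K.J (C ∪ B) x∈Y₁)
      ... | inj₁ x∈C = p⊆p∪q B (I⊆J x∈C)
      ... | inj₂ x∈B = q⊆p∪q J B x∈B

    ∣Y₂∣≤r : ∣ Y₂ ∣ ≤ rank M (D ∪ B)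
    ∣Y₂∣≤r = ∣indep∣≤rank (p∩q⊆q K.J (D ∪ B)) (indep-subset (p∩q⊆p K.J (D ∪ B)) K.indep)

  exchange-to-base : ∀ {A A₁ B} → IsBase M A → A₁ ⊆ A → Indep ((A ─ A₁) ∪ B) → Empty (A ∩ B) →
                     Σ (Subset n) λ A₂ → A₂ ⊆ A₁ × ∣ A₂ ∣ ≡ ∣ B ∣ × IsBase M ((A ─ A₂) ∪ B)
  exchange-to-base {A} {A₁} {B} baseA A₁⊆A indI A∩B-empty =
    A₂ , p─q⊆p A₁ J , ∣A₂∣≡∣B∣ , subst (IsBase M) (sym A─A₂∪B≡J) baseJ
    where
    open MaximalExtension (extend A indI)
    A₂ : Subset n
    A₂ = A₁ ─ J

    ∣A∣≤∣J∣ : ∣ A ∣ ≤ ∣ J ∣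
    ∣A∣≤∣J∣ = ∣indep∣≤∣maximal∣ indep maximal (proj₁ baseA) (q⊆p∪q J A)

    baseJ : IsBase M J
    baseJ = ∣base∣≤∣indep∣⇒base baseA indep ∣A∣≤∣J∣

    J⊆A∪B : J ⊆ A ∪ B
    J⊆A∪B {x} x∈J with x∈p∪q⁻ _ A (J⊆I∪S x∈J)
    ... | inj₂ x∈A = p⊆p∪q B x∈A
    ... | inj₁ x∈I with x∈p∪q⁻ (A ─ A₁) B x∈I
    ... | inj₁ x∈A─A₁ = p⊆p∪q B (p─q⊆p A A₁ x∈A─A₁)
    ... | inj₂ x∈B    = q⊆p∪q A B x∈B

    A─A₂∪B≡J : (A ─ A₂) ∪ B ≡ J
    A─A₂∪B≡J = p─[q─r]∪s≡r A A₁ B J I⊆J J⊆A∪B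

    ∣A₂∣≡∣B∣ : ∣ A₂ ∣ ≡ ∣ B ∣
    ∣A₂∣≡∣B∣ = +-cancelˡ-≡ ∣ A ─ A₂ ∣ _ _ (begin
      ∣ A ─ A₂ ∣ + ∣ A₂ ∣        ≡⟨ ∣p─q∣+∣q∣≡∣p∣ A A₂ (A₁⊆A ∘ p─q⊆p A₁ J) ⟩
      ∣ A ∣                      ≡⟨ ≤-antisym ∣A∣≤∣J∣ (∣indep∣≤∣base∣ baseA indep) ⟩
      ∣ J ∣                      ≡⟨ cong ∣_∣ (sym A─A₂∪B≡J) ⟩
      ∣ (A ─ A₂) ∪ B ∣           ≡⟨ Empty-∩⇒∣p∪q∣≡∣p∣+∣q∣ (A ─ A₂) B A─A₂∩B-empty ⟩
      ∣ A ─ A₂ ∣ + ∣ B ∣         ∎)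
      where
      open Relation.Binary.PropositionalEquality.≡-Reasoning
      A─A₂∩B-empty : Empty ((A ─ A₂) ∩ B)
      A─A₂∩B-empty (x , x∈) with x∈A─A₂ , x∈B ← x∈p∩q⁻ (A ─ A₂) B x∈ =
        A∩B-empty (x , x∈p∩q⁺ (p─q⊆p A A₂ x∈A─A₂ , x∈B))

  t≤∣J∩B∣ : ∀ {A A₁ B} t → Indep A → A₁ ⊆ A → Indep B → t + rank M (A₁ ∪ B) ≤ ∣ A₁ ∣ + ∣ B ∣ →
            (E : MaximalExtension (A ─ A₁) B) → t ≤ ∣ MaximalExtension.J E ∩ B ∣
  t≤∣J∩B∣ {A} {A₁} {B} t indA A₁⊆A indB t+r≤ E =
    +-cancelʳ-≤ r t ∣ J ∩ B ∣ (+-cancelˡ-≤ ∣ C ∣ (t + r) (∣ J ∩ B ∣ + r) (begin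
      ∣ C ∣ + (t + r)             ≤⟨ +-monoʳ-≤ ∣ C ∣ t+r≤ ⟩
      ∣ C ∣ + (∣ A₁ ∣ + ∣ B ∣)    ≡⟨ sym (+-assoc ∣ C ∣ _ _) ⟩
      ∣ C ∣ + ∣ A₁ ∣ + ∣ B ∣      ≡⟨ cong (_+ ∣ B ∣) (∣p─q∣+∣q∣≡∣p∣ A A₁ A₁⊆A) ⟩
      ∣ A ∣ + ∣ B ∣               ≤⟨ submodular-bound C A₁ indA A⊆C∪A₁ indB E ⟩
      ∣ J ∣ + r                   ≤⟨ +-monoˡ-≤ r ∣J∣≤∣C∣+∣J∩B∣ ⟩
      ∣ C ∣ + ∣ J ∩ B ∣ + r       ≡⟨ +-assoc ∣ C ∣ _ _ ⟩
      ∣ C ∣ + (∣ J ∩ B ∣ + r)     ∎))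
    where
    open ≤-Reasoning
    open MaximalExtension E
    C : Subset n
    C = A ─ A₁
    r : ℕ
    r = rank M (A₁ ∪ B)

    A⊆C∪A₁ : A ⊆ C ∪ A₁
    A⊆C∪A₁ {x} x∈A with x ∈? A₁
    ... | yes x∈A₁ = q⊆p∪q C A₁ x∈A₁
    ... | no  x∉A₁ = p⊆p∪q A₁ (x∈p∧x∉q⇒x∈p─q x∈A x∉A₁)

    ∣J∣≤∣C∣+∣J∩B∣ : ∣ J ∣ ≤ ∣ C ∣ + ∣ J ∩ B ∣
    ∣J∣≤∣C∣+∣J∩B∣ = ≤-trans (p⊆q⇒∣p∣≤∣q∣ J⊆C∪J∩B) (∣p∪q∣≤∣p∣+∣q∣ C (J ∩ B))
      where
      J⊆C∪J∩B : J ⊆ C ∪ (J ∩ B)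
      J⊆C∪J∩B {x} x∈J with x∈p∪q⁻ C B (J⊆I∪S x∈J)
      ... | inj₁ x∈C = p⊆p∪q _ x∈C
      ... | inj₂ x∈B = q⊆p∪q C _ (x∈p∩q⁺ (x∈J , x∈B))

lemma4 : ∀ {n : ℕ} (M : Matroid n) (A A₁ B₁ : Subset n) (t : ℕ) →
    IsBase M A → A₁ ⊆ A → Matroid.Indep M B₁ → A ∩ B₁ ≡ ⊥ →
    t + rank M (A₁ ∪ B₁) ≤ ∣ A₁ ∣ + ∣ B₁ ∣ →
    Σ (Subset n) λ A₂ → Σ (Subset n) λ B₂ →
      A₂ ⊆ A₁ × B₂ ⊆ B₁ × ∣ A₂ ∣ ≡ t × ∣ B₂ ∣ ≡ t ×
      IsBase M ((A ─ A₂) ∪ B₂)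
lemma4 {n} M A A₁ B₁ t baseA A₁⊆A indB₁ A∩B₁≡⊥ t+r≤ =
  let B₂ , B₂⊆J∩B₁ , ∣B₂∣≡t = ⊆-of-size (J ∩ B₁) t (t≤∣J∩B∣ M t (proj₁ baseA) A₁⊆A indB₁ t+r≤ E)
      A₂ , A₂⊆A₁ , ∣A₂∣≡∣B₂∣ , base = exchange-to-base M baseA A₁⊆A
        (indep-subset (A─A₁∪B₂⊆J B₂⊆J∩B₁) indep) (A∩B₂-empty B₂⊆J∩B₁)
  in A₂ , B₂ , A₂⊆A₁ , p∩q⊆q J B₁ ∘ B₂⊆J∩B₁ , trans ∣A₂∣≡∣B₂∣ ∣B₂∣≡t , ∣B₂∣≡t , base
  where
  open Matroid M using (indep-subset)
  E : MaximalExtension M (A ─ A₁) B₁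
  E = extend M {A ─ A₁} B₁ (indep-subset (p─q⊆p A A₁) (proj₁ baseA))
  open MaximalExtension E

  A─A₁∪B₂⊆J : ∀ {B₂} → B₂ ⊆ J ∩ B₁ → (A ─ A₁) ∪ B₂ ⊆ J
  A─A₁∪B₂⊆J {B₂} B₂⊆J∩B₁ {x} x∈ with x∈p∪q⁻ (A ─ A₁) B₂ x∈
  ... | inj₁ x∈A─A₁ = I⊆J x∈A─A₁
  ... | inj₂ x∈B₂   = p∩q⊆p J B₁ (B₂⊆J∩B₁ x∈B₂)

  A∩B₂-empty : ∀ {B₂} → B₂ ⊆ J ∩ B₁ → Empty (A ∩ B₂)
  A∩B₂-empty {B₂} B₂⊆J∩B₁ (x , x∈) with x∈A , x∈B₂ ← x∈p∩q⁻ A B₂ x∈ =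
    ∉⊥ (subst (x ∈_) A∩B₁≡⊥ (x∈p∩q⁺ (x∈A , p∩q⊆q J B₁ (B₂⊆J∩B₁ x∈B₂))))
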